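{- Let $\mathcal A$ be a deterministic (online or offline) algorithm for the stochastic rewards problem. Fix a resource $i\in I$ and a sample path $\omega_{ -i}$ of outcomes of all edges not incident to $i$. Then in the thresholding process for $i$ with threshold value $b\ge0$: (i) $\mathbb{1}(b)=1$ for every $b<\tau(\mathcal A)$; (ii) $\mathbb{1}(b)=0$ for every $b\ge\tau(\mathcal A)$.
   Context: Stochastic rewards matching: a bipartite graph $G=(I,T,E)$ with rewards $r_i$, unit capacities, and edge success probabilities $p_{it}$. Algorithms do not know the outcome of a match before making it. Thresholding process for resource $i$ with threshold $B_i=b$ (unknown to $\mathcal A$): run $\mathcal A$, where - matches on edges not incident to $i$ succeed according to $\omega_{ -i}$; - resource $i$ is successfully matched exactly at the first moment the sum of $p_{it}$ over all arrivals $t$ matched to $i$ so far (including the current one) exceeds $b$; earlier matches to $i$ fail. $\mathbb{1}(b)=\mathbb{1}(b,\mathcal A)$ indicates whether $i$ is successfully matched when $B_i=b$. $\mathcal A(b)$ denotes the ordered set of arrivals matched to $i$ when $B_i=b$. Effort threshold: $\tau(\mathcal A)=\sum_{t\in\mathcal A(+\infty)}p_{it}$.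
   Formalization: The edge success probabilities $p_{it}$ and the threshold value $b$ are rational. -}

module Defs where

open import Data.Nat using (ℕ; zero; suc)
open import Data.Fin using (Fin)
open import Data.Fin.Properties using () renaming (_≟_ to _≟ᶠ_)
open import Data.Bool using (Bool; true; false; _∧_; not; if_then_else_)
open import Data.List using (List; []; _∷_; _++_; [_]; foldr; map)
open import Data.Bool.ListAction using (any)
open import Data.Maybe using (Maybe; nothing; just)
open import Data.Product using (_×_; _,_)
open import Data.Rational using (ℚ; 0ℚ; _+_)
open import Data.Rational.Properties using (_<?_)
open import Relation.Nullary.Decidable using (does)

-- An instance with m resources (Fin m) and n arrivals (Fin n).
-- Edge success probabilities are given as p : Fin m → Fin n → ℚ
-- (a non-edge can be represented by probability 0).

record Step (m n : ℕ) : Set where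
  constructor step
  field
    res     : Fin m
    arr     : Fin n
    outcome : Bool
open Step public

History : ℕ → ℕ → Set
History m n = List (Step m n)

-- A deterministic (online or offline, adaptive) algorithm: given everything
-- observed so far, either stops (nothing) or attempts a match (j , t).
-- It never sees an outcome before making the match.
Algorithm : ℕ → ℕ → Set
Algorithm m n = History m n → Maybe (Fin m × Fin n)

data Threshold : Set where
  fin : ℚ → Threshold
  ∞   : Threshold

exceeds : Threshold → ℚ → Bool
exceeds (fin b) c = does (b <? c)
exceeds ∞       c = false

sumℚ : List ℚ → ℚ
sumℚ = foldr _+_ 0ℚ

isRes : {m : ℕ} → Fin m → Fin m → Bool
isRes i j = does (j ≟ᶠ i)

matchedTo : {m n : ℕ} → Fin m → History m n → List (Fin n)
matchedTo i []       = []
matchedTo i (s ∷ h)  = if isRes i (res s) then arr s ∷ matchedTo i h else matchedTo i h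

successOf : {m n : ℕ} → Fin m → History m n → Bool
successOf i h = any (λ s → isRes i (res s) ∧ outcome s) h

module Thresholding {m n : ℕ}
  (p : Fin m → Fin n → ℚ)
  (i : Fin m)
  (ω : Fin m → Fin n → Bool)    -- sample path ω_{-i} (values at i unused)
  (A : Algorithm m n)
  where

  outcomeAt : Threshold → History m n → Fin m → Fin n → Bool
  outcomeAt b h j t =
    if isRes i j
      then not (successOf i h) ∧ exceeds b (sumℚ (map (p i) (matchedTo i h)) + p i t)
      else ω j t

  run : Threshold → ℕ → History m n → History m n
  run b zero    h = h
  run b (suc k) h with A h
  ... | nothing      = h
  ... | just (j , t) = run b k (h ++ [ step j t (outcomeAt b h j t) ])

  -- the full thresholding process; every arrival is matched at most once,
  -- so at most n matches are made.
  process : Threshold → History m n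
  process b = run b n []

  𝟙 : Threshold → Bool
  𝟙 b = successOf i (process b)

  𝒜 : Threshold → List (Fin n)
  𝒜 b = matchedTo i (process b)

  τ : ℚ
  τ = sumℚ (map (p i) (𝒜 ∞))

{-# OPTIONS --safe #-}
-- With ω₋ᵢ fixed, the runs for B_i = b and B_i = +∞ make the same decisions
-- for as long as the effort spent on i stays at most b, since before that
-- point every match to i fails under both thresholds. If τ ≤ b the runs
-- therefore coincide, and i never succeeds at +∞. If b < τ, look at the
-- first match to i after which the effort exceeds b: the runs agree up to
-- it, and at it i is successfully matched under B_i = b.
module Submission where

open import Defs
open import Data.Nat using (ℕ; zero; suc)
open import Data.Fin using (Fin)
open import Data.Bool using (Bool; true; false; _∧_; _∨_; not)
open import Data.Bool.Properties using (∨-assoc; ∧-zeroʳ)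
open import Data.Product using (_×_; _,_)
open import Data.Maybe using (nothing; just)
open import Data.List using (List; []; _∷_; _++_; [_]; map)
open import Data.List.Properties using (map-++)
open import Data.Rational using (ℚ; 0ℚ; 1ℚ; _≤_; _<_; _+_)
open import Data.Rational.Properties
  using ( _<?_; +-identityˡ; +-identityʳ; +-assoc; +-monoʳ-≤
        ; ≤-refl; ≤-reflexive; ≤-trans; <-≤-trans; <-irrefl; ≮⇒≥; module ≤-Reasoning)
open import Relation.Nullary using (¬_; yes; no)
open import Relation.Nullary.Decidable using (dec-true; dec-false)
open import Relation.Binary.PropositionalEquality
  using (_≡_; refl; sym; trans; cong; cong₂; subst; module ≡-Reasoning)
open import Data.Empty using (⊥-elim)

sumℚ-++ : (xs ys : List ℚ) → sumℚ (xs ++ ys) ≡ sumℚ xs + sumℚ ys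
sumℚ-++ []       ys = sym (+-identityˡ _)
sumℚ-++ (x ∷ xs) ys = trans (cong (x +_) (sumℚ-++ xs ys)) (sym (+-assoc x _ _))

module _ {m n : ℕ} (i : Fin m) where

  matchedTo-++ : (h h′ : History m n) → matchedTo i (h ++ h′) ≡ matchedTo i h ++ matchedTo i h′
  matchedTo-++ []      h′ = refl
  matchedTo-++ (s ∷ h) h′ with isRes i (res s)
  ... | true  = cong (arr s ∷_) (matchedTo-++ h h′)
  ... | false = matchedTo-++ h h′

  successOf-++ : (h h′ : History m n) → successOf i (h ++ h′) ≡ successOf i h ∨ successOf i h′
  successOf-++ []      h′ = refl
  successOf-++ (s ∷ h) h′ =
    trans (cong (isRes i (res s) ∧ outcome s ∨_) (successOf-++ h h′))
          (sym (∨-assoc (isRes i (res s) ∧ outcome s) _ _))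

  successOf-++-true : (h h′ : History m n) → successOf i h ≡ true → successOf i (h ++ h′) ≡ true
  successOf-++-true h h′ success = trans (successOf-++ h h′) (cong (_∨ successOf i h′) success)

module ThresholdingProperties {m n : ℕ} (p : Fin m → Fin n → ℚ) (p≥0 : ∀ j t → 0ℚ ≤ p j t)
                              (A : Algorithm m n) (i : Fin m) (ω : Fin m → Fin n → Bool) where
  open Thresholding p i ω A

  effort : History m n → ℚ
  effort h = sumℚ (map (p i) (matchedTo i h))

  next : Threshold → History m n → Fin m → Fin n → History m n
  next β h j t = h ++ [ step j t (outcomeAt β h j t) ]

  effort-++ : (h h′ : History m n) → effort (h ++ h′) ≡ effort h + effort h′
  effort-++ h h′ = begin
    sumℚ (map (p i) (matchedTo i (h ++ h′)))
      ≡⟨ cong (λ ts → sumℚ (map (p i) ts)) (matchedTo-++ i h h′) ⟩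
    sumℚ (map (p i) (matchedTo i h ++ matchedTo i h′))
      ≡⟨ cong sumℚ (map-++ (p i) (matchedTo i h) (matchedTo i h′)) ⟩
    sumℚ (map (p i) (matchedTo i h) ++ map (p i) (matchedTo i h′))
      ≡⟨ sumℚ-++ (map (p i) (matchedTo i h)) (map (p i) (matchedTo i h′)) ⟩
    effort h + effort h′ ∎
    where open ≡-Reasoning

  effort-snoc-i : ∀ h s → isRes i (res s) ≡ true → effort (h ++ [ s ]) ≡ effort h + p i (arr s)
  effort-snoc-i h s e = trans (effort-++ h [ s ]) (cong (effort h +_) effort-s)
    where
    effort-s : effort [ s ] ≡ p i (arr s)
    effort-s rewrite e = +-identityʳ (p i (arr s))

  effort-snoc-other : ∀ h s → isRes i (res s) ≡ false → effort (h ++ [ s ]) ≡ effort h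
  effort-snoc-other h s e =
    trans (effort-++ h [ s ]) (trans (cong (effort h +_) effort-s) (+-identityʳ (effort h)))
    where
    effort-s : effort [ s ] ≡ 0ℚ
    effort-s rewrite e = refl

  effort-≤-snoc : ∀ h s → effort h ≤ effort (h ++ [ s ])
  effort-≤-snoc h s with isRes i (res s) in e
  ... | true  = begin
    effort h                ≡⟨ sym (+-identityʳ (effort h)) ⟩
    effort h + 0ℚ           ≤⟨ +-monoʳ-≤ (effort h) (p≥0 i (arr s)) ⟩
    effort h + p i (arr s)  ≡⟨ sym (effort-snoc-i h s e) ⟩
    effort (h ++ [ s ])     ∎
    where open ≤-Reasoning
  ... | false = ≤-reflexive (sym (effort-snoc-other h s e))

  effort-≤-run : ∀ β k h → effort h ≤ effort (run β k h)
  effort-≤-run β zero    h = ≤-refl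
  effort-≤-run β (suc k) h with A h
  ... | nothing      = ≤-refl
  ... | just (j , t) = ≤-trans (effort-≤-snoc h _) (effort-≤-run β k (next β h j t))

  successOf-run-mono : ∀ β k h → successOf i h ≡ true → successOf i (run β k h) ≡ true
  successOf-run-mono β zero    h success = success
  successOf-run-mono β (suc k) h success with A h
  ... | nothing      = success
  ... | just (j , t) = successOf-run-mono β k (next β h j t) (successOf-++-true i h _ success)

  outcomeAt-∞-i : ∀ h j t → isRes i j ∧ outcomeAt ∞ h j t ≡ false
  outcomeAt-∞-i h j t with isRes i j
  ... | true  = ∧-zeroʳ (not (successOf i h))
  ... | false = refl

  successOf-next-∞ : ∀ h j t → successOf i h ≡ false → successOf i (next ∞ h j t) ≡ false
  successOf-next-∞ h j t no-success =
    trans (successOf-++ i h _) (cong₂ _∨_ no-success (cong (_∨ false) (outcomeAt-∞-i h j t)))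

  successOf-run-∞ : ∀ k h → successOf i h ≡ false → successOf i (run ∞ k h) ≡ false
  successOf-run-∞ zero    h no-success = no-success
  successOf-run-∞ (suc k) h no-success with A h
  ... | nothing      = no-success
  ... | just (j , t) = successOf-run-∞ k (next ∞ h j t) (successOf-next-∞ h j t no-success)

  next-fin≡next-∞ : ∀ b h j t → effort (next ∞ h j t) ≤ b → next (fin b) h j t ≡ next ∞ h j t
  next-fin≡next-∞ b h j t bound = cong (λ o → h ++ [ step j t o ]) outcome-fin≡∞
    where
    outcome-fin≡∞ : outcomeAt (fin b) h j t ≡ outcomeAt ∞ h j t
    outcome-fin≡∞ with isRes i j in e
    ... | true  = cong (not (successOf i h) ∧_) (dec-false (b <? _) not-exceeded)
      where
      not-exceeded : ¬ b < effort h + p i t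
      not-exceeded b< = <-irrefl refl (<-≤-trans b< (subst (_≤ b) (effort-snoc-i h _ e) bound))
    ... | false = refl

  effort-crosses-only-at-i : ∀ b h s → effort h ≤ b → b < effort (h ++ [ s ]) → isRes i (res s) ≡ true
  effort-crosses-only-at-i b h s le b< with isRes i (res s) in e
  ... | true  = refl
  ... | false = ⊥-elim (<-irrefl refl (<-≤-trans b< (subst (_≤ b) (sym (effort-snoc-other h s e)) le)))

  outcomeAt-fin-i : ∀ b h j t → isRes i j ≡ true → successOf i h ≡ false → b < effort h + p i t
                  → isRes i j ∧ outcomeAt (fin b) h j t ≡ true
  outcomeAt-fin-i b h j t e no-success b< rewrite e | no-success = dec-true (b <? _) b<

  successOf-next-fin : ∀ b h j t → successOf i h ≡ false → effort h ≤ b → b < effort (next ∞ h j t)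
                     → successOf i (next (fin b) h j t) ≡ true
  successOf-next-fin b h j t no-success le b< =
    trans (successOf-++ i h _)
          (cong₂ _∨_ no-success (cong (_∨ false) (outcomeAt-fin-i b h j t at-i no-success b<′)))
    where
    at-i : isRes i j ≡ true
    at-i = effort-crosses-only-at-i b h _ le b<
    b<′ : b < effort h + p i t
    b<′ = subst (b <_) (effort-snoc-i h _ at-i) b<

  run-fin≡run-∞ : ∀ b k h → effort (run ∞ k h) ≤ b → run (fin b) k h ≡ run ∞ k h
  run-fin≡run-∞ b zero    h _ = refl
  run-fin≡run-∞ b (suc k) h bound with A h
  ... | nothing      = refl
  ... | just (j , t) rewrite next-fin≡next-∞ b h j t (≤-trans (effort-≤-run ∞ k (next ∞ h j t)) bound) =
    run-fin≡run-∞ b k (next ∞ h j t) bound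

  successOf-run-fin : ∀ b k h → successOf i h ≡ false → effort h ≤ b → b < effort (run ∞ k h)
                    → successOf i (run (fin b) k h) ≡ true
  successOf-run-fin b zero    h _ le b< = ⊥-elim (<-irrefl refl (<-≤-trans b< le))
  successOf-run-fin b (suc k) h no-success le b< with A h
  ... | nothing      = ⊥-elim (<-irrefl refl (<-≤-trans b< le))
  ... | just (j , t) with b <? effort (next ∞ h j t)
  ...   | yes crossed =
    successOf-run-mono (fin b) k (next (fin b) h j t) (successOf-next-fin b h j t no-success le crossed)
  ...   | no  b≮      rewrite next-fin≡next-∞ b h j t (≮⇒≥ b≮) =
    successOf-run-fin b k (next ∞ h j t) (successOf-next-∞ h j t no-success) (≮⇒≥ b≮) b<

lemma7 : {m n : ℕ} (p : Fin m → Fin n → ℚ)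
         → (∀ j t → 0ℚ ≤ p j t) → (∀ j t → p j t ≤ 1ℚ)
         → (A : Algorithm m n) (i : Fin m) (ω : Fin m → Fin n → Bool)
         → ((b : ℚ) → 0ℚ ≤ b → b < Thresholding.τ p i ω A
              → Thresholding.𝟙 p i ω A (fin b) ≡ true)
           × ((b : ℚ) → 0ℚ ≤ b → Thresholding.τ p i ω A ≤ b
              → Thresholding.𝟙 p i ω A (fin b) ≡ false)
lemma7 {n = n} p p≥0 _ A i ω = below-τ , above-τ
  where
  open Thresholding p i ω A using (τ; 𝟙)
  open ThresholdingProperties p p≥0 A i ω

  below-τ : (b : ℚ) → 0ℚ ≤ b → b < τ → 𝟙 (fin b) ≡ true
  below-τ b 0≤b b<τ = successOf-run-fin b n [] refl 0≤b b<τ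

  above-τ : (b : ℚ) → 0ℚ ≤ b → τ ≤ b → 𝟙 (fin b) ≡ false
  above-τ b _ τ≤b = trans (cong (successOf i) (run-fin≡run-∞ b n [] τ≤b)) (successOf-run-∞ n [] refl)
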